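{- Let $\xi,\eta\in\mathrm{IS}$, $X\in\mathbb P$ and $F\in\mathbf C$. If $F$ is reducible to $\xi$ on $X$ and reducible to $\eta$ on $X$, then $F$ is reducible to $\xi\cap\eta$ on $X$.
   Context: Fix a countable partially ordered set $I$. $\mathcal D=2^\omega$. For $\xi\subseteq I$, $\mathcal D^\xi$ is the product of $\xi$ copies of $\mathcal D$; $x\restriction\xi$ is restriction, $X\restriction\xi=\{x\restriction\xi:x\in X\}$. $\mathrm{IS}$ is the set of initial (downward closed) subsets of $I$. $[<i]=\{j:j<i\}$; $X\restriction_{<i}=X\restriction[<i]$. For $i\in\xi\in\mathrm{IS}$, $X\subseteq\mathcal D^\xi$, $z\in X\restriction_{<i}$: $D_{Xz}(i)=\{x(i):x\in X,x\restriction_{<i}=z\}$. For $\zeta\in\mathrm{IS}$, $\mathbb P'_\zeta$ is the set of $X\subseteq\mathcal D^\zeta$ with: (P1) closed nonempty; (P2) each $D_{Xz}(i)$ perfect; (P3) for $i\in\zeta$, open $G\subseteq\mathcal D$, $\{x\restriction_{<i}:x\in X,x(i)\in G\}$ open in $X\restriction_{<i}$; (P4) if $\xi,\eta\in\mathrm{IS}$, $\xi\cup\eta\subseteq\zeta$, $x\in X\restriction\xi$, $y\in X\restriction\eta$, $x\restriction(\xi\cap\eta)=y\restriction(\xi\cap\eta)$, then $x\cup y\in X\restriction(\xi\cup\eta)$. For $A\subseteq\mathcal D$ with at least two points, $l$ = length of the longest common finite initial segment of elements of $A$, $\mathrm{Spl}(A,e)=\{a\in A:a(l)=e\}$; $\mathrm{Spl}(X,i,e)=\{x\in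 X:x(i)\in\mathrm{Spl}(D_{X,x\restriction_{<i}}(i),e)\}$. For $\Phi:\omega\to\zeta$ taking each value infinitely often: $X_\Phi[\Lambda]=X$, $X_\Phi[u^\frown e]=\mathrm{Spl}(X_\Phi[u],\Phi(m),e)$ ($u\in2^m$), $X_\Phi[a]=\bigcap_mX_\Phi[a\restriction m]$; $X$ is shrinkable if all $X_\Phi[a]$ are singletons. $\mathbb P_\zeta$ = shrinkable members of $\mathbb P'_\zeta$; $\mathbb P=\mathbb P_I$. $\mathbf C$ is the set of continuous $F:\mathcal D^I\to\omega^\omega$. $F$ is reducible to $\xi\in\mathrm{IS}$ on $X$ if $F(x)=F(y)$ for all $x,y\in X$ with $x\restriction\xi=y\restriction\xi$. -}

module Defs where

open import Data.Nat using (ℕ; _<_)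
open import Data.Bool using (Bool)
open import Data.List using (List)
open import Data.List.Relation.Unary.Any using (Any)
open import Data.Product using (Σ; ∃; _×_; _,_)
open import Relation.Binary.PropositionalEquality using (_≡_; _≢_)
open import Relation.Binary.Structures using (IsPartialOrder)
open import Function.Definitions using (Injective)
open import Level using (0ℓ)

-- A countable partially ordered set: a partial order (w.r.t. _≡_) on a
-- carrier together with an injection into ℕ (so finite sets are allowed).
record CPoset : Set₁ where
  field
    Carrier        : Set
    _≤_            : Carrier → Carrier → Set
    isPartialOrder : IsPartialOrder _≡_ _≤_
    enc            : Carrier → ℕ
    enc-injective  : Injective _≡_ _≡_ enc

module WithPoset (P : CPoset) where
  open CPoset P

  I : Set
  I = Carrier

  _≺_ : I → I → Set
  j ≺ i = (j ≤ i) × (j ≢ i)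

  SubI : Set₁
  SubI = I → Set

  IsInitial : SubI → Set
  IsInitial ξ = ∀ i j → j ≤ i → ξ i → ξ j

  below : I → SubI
  below i j = j ≺ i

  _∩I_ : SubI → SubI → SubI
  (ξ ∩I η) i = ξ i × η i

  D : Set
  D = ℕ → Bool

  -- points of D^I.  An element of D^ξ is represented by a point of D^I,
  -- considered only up to its values on ξ (see `agree`).
  Pt : Set
  Pt = I → D

  SubD : Set₁
  SubD = D → Set

  SubPt : Set₁
  SubPt = Pt → Set

  agree : SubI → Pt → Pt → Set
  agree ξ x y = ∀ j → ξ j → ∀ n → x j n ≡ y j n

  _≈P_ : Pt → Pt → Set
  x ≈P y = ∀ j n → x j n ≡ y j n

  _∈L_ : I → List I → Set
  j ∈L L = Any (j ≡_) L

  agreeNbhd : SubI → List I → ℕ → Pt → Pt → Set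
  agreeNbhd ξ L m x y = ∀ j → j ∈L L → ξ j → ∀ k → k < m → x j k ≡ y j k

  restrict : SubPt → SubI → SubPt
  restrict X ξ z = ∃ λ x → X x × agree ξ x z

  Dsec : SubPt → Pt → I → SubD
  Dsec X z i d = ∃ λ x → X x × agree (below i) x z × (∀ n → x i n ≡ d n)

  agreeBelow : ℕ → D → D → Set
  agreeBelow m a b = ∀ k → k < m → a k ≡ b k

  ClosedD : SubD → Set
  ClosedD A = ∀ d → (∀ m → ∃ λ a → A a × agreeBelow m a d) → A d

  OpenD : SubD → Set
  OpenD G = ∀ d → G d → ∃ λ m → ∀ e → agreeBelow m d e → G e

  PerfectD : SubD → Set
  PerfectD A = (∃ λ a → A a) × ClosedD A ×
    (∀ a → A a → ∀ m → ∃ λ b → A b × agreeBelow m a b × ∃ λ k → b k ≢ a k)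

  ClosedPt : SubPt → Set
  ClosedPt X = ∀ y → (∀ (L : List I) m → ∃ λ x → X x × agreeNbhd (λ _ → Data.Unit.⊤) L m x y) → X y
    where import Data.Unit

  P1 : SubPt → Set
  P1 X = ClosedPt X × (∃ λ x → X x)

  P2 : SubPt → Set
  P2 X = ∀ i z → restrict X (below i) z → PerfectD (Dsec X z i)

  RelOpen : SubPt → SubI → SubPt → Set
  RelOpen X ξ S = ∀ z → S z → ∃ λ L → ∃ λ m →
    ∀ w → restrict X ξ w → agreeNbhd ξ L m z w → S w

  P3 : SubPt → Set₁
  P3 X = ∀ i (G : SubD) → OpenD G →
    RelOpen X (below i) (λ z → ∃ λ x → X x × agree (below i) x z × G (x i))

  P4 : SubPt → Set₁
  P4 X = ∀ ξ η → IsInitial ξ → IsInitial η → ∀ x y →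
    restrict X ξ x → restrict X η y → agree (ξ ∩I η) x y →
    ∃ λ w → X w × agree ξ w x × agree η w y

  P' : SubPt → Set₁
  P' X = P1 X × P2 X × P3 X × P4 X

  -- l is the length of the longest common initial segment of elements of A
  -- (A has at least two points iff such l exists)
  SplitLevel : SubD → ℕ → Set
  SplitLevel A l = (∀ a b → A a → A b → agreeBelow l a b) ×
    (∃ λ a → ∃ λ b → A a × A b × a l ≢ b l)

  SplD : SubD → Bool → SubD
  SplD A e a = A a × ∃ λ l → SplitLevel A l × a l ≡ e

  Spl : SubPt → I → Bool → SubPt
  Spl X i e x = X x × SplD (Dsec X x i) e (x i)

  XΦ : SubPt → (ℕ → I) → (ℕ → Bool) → ℕ → SubPt
  XΦ X Φ a ℕ.zero = X
  XΦ X Φ a (ℕ.suc m) = Spl (XΦ X Φ a m) (Φ m) (a m)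

  XΦ∞ : SubPt → (ℕ → I) → (ℕ → Bool) → SubPt
  XΦ∞ X Φ a x = ∀ m → XΦ X Φ a m x

  InfOften : (ℕ → I) → Set
  InfOften Φ = ∀ i n → ∃ λ m → (n Data.Nat.≤ m) × Φ m ≡ i

  Singleton : SubPt → Set
  Singleton S = ∃ λ x → S x × (∀ y → S y → y ≈P x)

  Shrinkable : SubPt → Set
  Shrinkable X = ∀ Φ → InfOften Φ → ∀ a → Singleton (XΦ∞ X Φ a)

  InP : SubPt → Set₁
  InP X = P' X × Shrinkable X

  Baire : Set
  Baire = ℕ → ℕ

  IsContinuous : (Pt → Baire) → Set
  IsContinuous F = ∀ x n → ∃ λ L → ∃ λ m →
    ∀ y → agreeNbhd (λ _ → Data.Unit.⊤) L m x y → F y n ≡ F x n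
    where import Data.Unit

  ReducibleOn : (Pt → Baire) → SubI → SubPt → Set
  ReducibleOn F ξ X = ∀ x y → X x → X y → agree ξ x y → ∀ n → F x n ≡ F y n

module Submission where

open import Defs
open import Data.Product using (_,_; ∃; _×_)
open import Relation.Binary.PropositionalEquality using (refl; sym; trans)

-- Amalgamate x on ξ with y on η into a single w ∈ X (condition (P4));
-- then F x = F w by reducibility to ξ and F w = F y by reducibility to η.

module _ (P : CPoset) where
  open WithPoset P

  agree-sym : ∀ {ξ x y} → agree ξ x y → agree ξ y x
  agree-sym x~y j ξj n = sym (x~y j ξj n)

  restrict-self : ∀ {X ξ x} → X x → restrict X ξ x
  restrict-self {x = x} Xx = x , Xx , λ _ _ _ → refl

  P4⇒amalgamate : ∀ {X ξ η x y} → P4 X → IsInitial ξ → IsInitial η →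
    X x → X y → agree (ξ ∩I η) x y →
    ∃ λ w → X w × agree ξ x w × agree η w y
  P4⇒amalgamate {ξ = ξ} {η} {x} {y} p4 iξ iη Xx Xy x~y
    with p4 ξ η iξ iη x y (restrict-self Xx) (restrict-self Xy) x~y
  ... | w , Xw , w~x , w~y = w , Xw , agree-sym w~x , w~y

  ReducibleOn-∩ : ∀ {X ξ η} (F : Pt → Baire) → P4 X →
    IsInitial ξ → IsInitial η →
    ReducibleOn F ξ X → ReducibleOn F η X → ReducibleOn F (ξ ∩I η) X
  ReducibleOn-∩ F p4 iξ iη redξ redη x y Xx Xy x~y n
    with P4⇒amalgamate p4 iξ iη Xx Xy x~y
  ... | w , Xw , x~w , w~y = trans (redξ x w Xx Xw x~w n) (redη w y Xw Xy w~y n)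

lemma10 : (P : CPoset) → let open WithPoset P in
    ∀ (ξ η : SubI) (X : SubPt) (F : Pt → Baire) →
    IsInitial ξ → IsInitial η → InP X → IsContinuous F →
    ReducibleOn F ξ X → ReducibleOn F η X →
    ReducibleOn F (ξ ∩I η) X
lemma10 P ξ η X F iξ iη ((_ , _ , _ , p4) , _) _ =
  ReducibleOn-∩ P F p4 iξ iη
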